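{- Let $u$ be an odd prime and let $(x,y,z,n)$ be an exceptional solution of $[(u^2-4)n]^x+(4un)^y=[(u^2+4)n]^z$, with associated decomposition $u^2-4=u_1u_2$. Then $u_1>1$, $u_2>1$, and one of the following holds: (1) $u_1\equiv 1\pmod 8$ and $\nu_2(z)=\nu_2(u_1-1)+\nu_2(x)-2$; (2) $u_1\equiv 7\pmod 8$, $\nu_2(z)=\nu_2(u_1+1)+\nu_2(x)-2$ and $\nu_2(x)\ge 1$; (3) $u_1\equiv 5\pmod 8$, $u_2$ is a perfect square and $\nu_2(z)=\nu_2(x)$.
   Context: Let $u$ be an odd prime. A solution $(x,y,z,n)$ in positive integers of $[(u^2-4)n]^x+(4un)^y=[(u^2+4)n]^z$ is exceptional if $n>1$ and $(x,y,z)\ne(2,2,2)$. It is known that every exceptional solution satisfies $y>z>x$; moreover $\gcd(n,u^2+4)=1$ and there are unique coprime positive integers $u_1,u_2$ with $u_1u_2=u^2-4$, $(u^2+4)^z-(4u)^yn^{y-z}=u_1^x$ and $n^{z-x}=u_2^x$ (the associated decomposition). $\nu_2(t)$ is the exponent of $2$ in $t$. -}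

module Defs where

open import Data.Nat using (ℕ; zero; suc; _+_; _*_; _∸_; _^_; _<_; _%_; _/_; _≟_)
open import Data.Nat.Primality using (Prime)
open import Data.Nat.Coprimality using (Coprime)
open import Data.Product using (_×_; ∃)
open import Relation.Binary.PropositionalEquality using (_≡_; _≢_)
open import Relation.Nullary using (¬_; yes; no)

-- ν₂-go fuel t : exponent of 2 in t, computed with fuel (fuel t suffices since t/2 < t).
ν₂-go : ℕ → ℕ → ℕ
ν₂-go zero _ = 0
ν₂-go (suc f) t with t ≟ 0
... | yes _ = 0
... | no _ with t % 2 ≟ 0
...   | yes _ = suc (ν₂-go f (t / 2))
...   | no _ = 0

-- 2-adic valuation ν₂(t) (convention ν₂(0) = 0; only applied to positive arguments here)
ν₂ : ℕ → ℕ
ν₂ t = ν₂-go t t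

OddPrime : ℕ → Set
OddPrime u = Prime u × u % 2 ≡ 1

IsSolution : ℕ → ℕ → ℕ → ℕ → ℕ → Set
IsSolution u x y z n =
  0 < x × 0 < y × 0 < z × 0 < n ×
  ((u * u ∸ 4) * n) ^ x + (4 * u * n) ^ y ≡ ((u * u + 4) * n) ^ z

IsExceptional : ℕ → ℕ → ℕ → ℕ → ℕ → Set
IsExceptional u x y z n =
  IsSolution u x y z n × 1 < n × ¬ (x ≡ 2 × y ≡ 2 × z ≡ 2)

-- The first equation is written additively (equivalent since the subtraction is exact).
IsAssocDecomp : ℕ → ℕ → ℕ → ℕ → ℕ → ℕ → ℕ → Set
IsAssocDecomp u x y z n u₁ u₂ =
  0 < u₁ × 0 < u₂ × Coprime u₁ u₂ × u₁ * u₂ ≡ u * u ∸ 4 ×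
  (4 * u) ^ y * n ^ (y ∸ z) + u₁ ^ x ≡ (u * u + 4) ^ z ×
  n ^ (z ∸ x) ≡ u₂ ^ x

IsSquare : ℕ → Set
IsSquare m = ∃ λ k → m ≡ k * k

{-# OPTIONS --safe #-}
module Submission where

-- Since u is odd, u² + 4 ≡ 5 (mod 8), so by lifting the exponent (u² + 4)^z − 1 is divisible by
-- exactly 2^(2 + ν₂ z).  The term (4u)^y n^(y−z) is divisible by 2^(2y), a strictly higher power
-- because ν₂ z < z < y, hence u₁^x − 1 is also divisible by exactly 2^(2 + ν₂ z).  Lifting the
-- exponent once more, now for u₁ (odd, as u₁u₂ = u² − 4 ≡ 5 mod 8), computes ν₂(u₁^x − 1) from
-- u₁ mod 8 and ν₂ x, which gives the three cases.  When ν₂ x = ν₂ z, the equation n^(z−x) = u₂^x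
-- makes u₂ a square, and that excludes u₁ ≡ 3 (mod 8).

open import Defs
open import Data.Nat
open import Data.Nat.Properties
open import Data.Nat.DivMod
open import Data.Nat.Divisibility
open import Data.Nat.GCD using (gcd; gcd[m,n]∣m; gcd[m,n]∣n; gcd[m,n]≢0)
open import Data.Nat.Coprimality using (coprime-divisor; coprime-/gcd)
open import Data.Nat.Primality using (prime)
open import Data.Product
open import Data.Sum
open import Data.Empty
open import Relation.Nullary using (¬_; yes; no)
open import Relation.Binary.Definitions using (tri<; tri≈; tri>)
open import Relation.Binary.PropositionalEquality
open import Data.Nat.Tactic.RingSolver

private variable
  a b c e i j k l m n s t x y z : ℕ

even⊎odd : ∀ n → (∃[ h ] n ≡ 2 * h) ⊎ (∃[ h ] n ≡ 1 + 2 * h)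
even⊎odd zero = inj₁ (0 , refl)
even⊎odd (suc n) with even⊎odd n
... | inj₁ (h , refl) = inj₂ (h , refl)
... | inj₂ (h , refl) = inj₁ (suc h , sym (*-suc 2 h))

n<2^n : ∀ n → n < 2 ^ n
n<2^n zero = s≤s z≤n
n<2^n (suc n) = +-mono-≤ (m^n>0 2 n) (≤-trans (n<2^n n) (m≤m+n (2 ^ n) 0))

^-monoʳ-∣ : ∀ m → i ≤ j → m ^ i ∣ m ^ j
^-monoʳ-∣ {i} {j} m i≤j = divides (m ^ (j ∸ i)) (begin
  m ^ j                ≡⟨ cong (m ^_) (sym (m+[n∸m]≡n i≤j)) ⟩
  m ^ (i + (j ∸ i))    ≡⟨ ^-distribˡ-+-* m i (j ∸ i) ⟩
  m ^ i * m ^ (j ∸ i)  ≡⟨ *-comm (m ^ i) _ ⟩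
  m ^ (j ∸ i) * m ^ i  ∎)
  where open ≡-Reasoning

^-monoˡ-∣ : ∀ k → m ∣ n → m ^ k ∣ n ^ k
^-monoˡ-∣ zero m∣n = ∣-refl
^-monoˡ-∣ (suc k) m∣n = *-pres-∣ m∣n (^-monoˡ-∣ k m∣n)

^-cancelʳ-≡ : ∀ k → 0 < k → m ^ k ≡ n ^ k → m ≡ n
^-cancelʳ-≡ {m} {n} k 0<k eq with <-cmp m n
... | tri< m<n _ _ = ⊥-elim (<⇒≢ (^-monoˡ-< k ⦃ >-nonZero 0<k ⦄ m<n) eq)
... | tri≈ _ m≡n _ = m≡n
... | tri> _ _ n<m = ⊥-elim (<⇒≢ (^-monoˡ-< k ⦃ >-nonZero 0<k ⦄ n<m) (sym eq))

^-double : ∀ a e → a ^ (2 * e) ≡ (a * a) ^ e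
^-double a e = trans (sym (^-*-assoc a 2 e)) (cong (λ b → (a * b) ^ e) (*-identityʳ a))

^-odd-suc : ∀ a m → a ^ (1 + 2 * suc m) ≡ a * a * a ^ (1 + 2 * m)
^-odd-suc a m = begin
  a ^ (1 + 2 * suc m)      ≡⟨ cong (a ^_) (lemma m) ⟩
  a ^ (2 + (1 + 2 * m))    ≡⟨ ^-distribˡ-+-* a 2 (1 + 2 * m) ⟩
  a ^ 2 * a ^ (1 + 2 * m)  ≡⟨ cong (λ b → a * b * a ^ (1 + 2 * m)) (*-identityʳ a) ⟩
  a * a * a ^ (1 + 2 * m)  ∎
  where
  open ≡-Reasoning
  lemma : ∀ m → 1 + 2 * suc m ≡ 2 + (1 + 2 * m)
  lemma = solve-∀

^-2^suc : ∀ a k o → a ^ (2 ^ suc k * o) ≡ (a * a) ^ (2 ^ k * o)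
^-2^suc a k o = trans (cong (a ^_) (*-assoc 2 (2 ^ k) o)) (^-double a (2 ^ k * o))

1<^⇒1< : ∀ a e → 1 < a ^ e → 1 < a
1<^⇒1< zero zero (s≤s ())
1<^⇒1< zero (suc e) ()
1<^⇒1< (suc zero) e 1<1ᵉ = ⊥-elim (<-irrefl (sym (^-zeroˡ e)) 1<1ᵉ)
1<^⇒1< (suc (suc a)) e _ = s≤s (s≤s z≤n)

m*n∸1≡[m∸1]*n+[n∸1] : ∀ m n → 0 < m → 0 < n → m * n ∸ 1 ≡ (m ∸ 1) * n + (n ∸ 1)
m*n∸1≡[m∸1]*n+[n∸1] (suc m) (suc n) _ _ = +-comm n (m * suc n)

[m∸1]*[m+1]≡m*m∸1 : ∀ m → (m ∸ 1) * (m + 1) ≡ m * m ∸ 1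
[m∸1]*[m+1]≡m*m∸1 zero = refl
[m∸1]*[m+1]≡m*m∸1 (suc m) = lemma m
  where
  lemma : ∀ m → m * (suc m + 1) ≡ m + m * suc m
  lemma = solve-∀

2∤1+2* : ∀ m → ¬ 2 ∣ 1 + 2 * m
2∤1+2* m (divides q eq) = even≢odd q m (trans (*-comm 2 q) (sym eq))

square-cofactor : 0 < c → b * (c * c) ≡ e * e → IsSquare b
square-cofactor {c} {b} {e} 0<c eq = e / g , (begin
  b                          ≡⟨ sym (*-identityʳ b) ⟩
  b * (1 * 1)                ≡⟨ cong (λ t → b * (t * t)) (sym c/g≡1) ⟩
  b * (c / g * (c / g))      ≡⟨ reduced ⟩
  e / g * (e / g)            ∎)
  where
  open ≡-Reasoning
  g = gcd c e
  instance
    g≢0 : NonZero g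
    g≢0 = ≢-nonZero (gcd[m,n]≢0 c e (inj₁ (λ c≡0 → <⇒≢ 0<c (sym c≡0))))
    g*g≢0 : NonZero (g * g)
    g*g≢0 = m*n≢0 g g
  c≡ : c ≡ c / g * g
  c≡ = sym (m/n*n≡m (gcd[m,n]∣m c e))
  e≡ : e ≡ e / g * g
  e≡ = sym (m/n*n≡m (gcd[m,n]∣n c e))
  scale : ∀ b c g → b * (c * g * (c * g)) ≡ b * (c * c) * (g * g)
  scale = solve-∀
  square-scale : ∀ e g → e * g * (e * g) ≡ e * e * (g * g)
  square-scale = solve-∀
  reduced : b * (c / g * (c / g)) ≡ e / g * (e / g)
  reduced = *-cancelʳ-≡ _ _ (g * g) (begin
    b * (c / g * (c / g)) * (g * g)      ≡⟨ sym (scale b (c / g) g) ⟩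
    b * (c / g * g * (c / g * g))        ≡⟨ cong (λ t → b * (t * t)) (sym c≡) ⟩
    b * (c * c)                          ≡⟨ eq ⟩
    e * e                                ≡⟨ cong (λ t → t * t) e≡ ⟩
    e / g * g * (e / g * g)              ≡⟨ square-scale (e / g) g ⟩
    e / g * (e / g) * (g * g)            ∎)
  c/g∣[e/g]² : c / g ∣ e / g * (e / g)
  c/g∣[e/g]² = divides (b * (c / g)) (trans (sym reduced) (sym (*-assoc b (c / g) (c / g))))
  c/g≡1 : c / g ≡ 1
  c/g≡1 = coprime-/gcd c e (∣-refl , coprime-divisor (coprime-/gcd c e) c/g∣[e/g]²)

infix 4 2^_∥_

-- A record rather than a Σ-type, so that k and t remain inferable from a proof.
record 2^_∥_ (k t : ℕ) : Set where
  constructor exact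
  field
    q : ℕ
    factorisation : t ≡ 2 ^ k * (1 + 2 * q)

∥⇒0< : 2^ k ∥ t → 0 < t
∥⇒0< {k} (exact m refl) = *-mono-≤ (m^n>0 2 k) (s≤s z≤n)

∥⇒< : 2^ k ∥ t → k < t
∥⇒< {k} (exact m refl) = ≤-trans (n<2^n k) (m≤m*n (2 ^ k) (1 + 2 * m))

∥⇒∣ : 2^ k ∥ t → 2 ^ k ∣ t
∥⇒∣ (exact m refl) = m∣m*n (1 + 2 * m)

∥⇒∤ : 2^ k ∥ t → ¬ 2 ^ suc k ∣ t
∥⇒∤ {k} (exact m refl) 2ᵏ⁺¹∣t =
  2∤1+2* m (*-cancelˡ-∣ (2 ^ k) ⦃ m^n≢0 2 k ⦄ (subst (_∣ 2 ^ k * (1 + 2 * m)) (*-comm 2 (2 ^ k)) 2ᵏ⁺¹∣t))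

∣∧∤⇒∥ : 2 ^ k ∣ t → ¬ 2 ^ suc k ∣ t → 2^ k ∥ t
∣∧∤⇒∥ {k} (divides r refl) 2ᵏ⁺¹∤t with even⊎odd r
... | inj₁ (h , refl) = ⊥-elim (2ᵏ⁺¹∤t (divides h (lemma h (2 ^ k))))
  where
  lemma : ∀ h P → 2 * h * P ≡ h * (2 * P)
  lemma = solve-∀
... | inj₂ (h , refl) = exact h (*-comm (1 + 2 * h) (2 ^ k))

∣-∥⇒≤ : 2 ^ j ∣ t → 2^ k ∥ t → j ≤ k
∣-∥⇒≤ 2ʲ∣t t∥ = ≮⇒≥ (λ k<j → ∥⇒∤ t∥ (∣-trans (^-monoʳ-∣ 2 k<j) 2ʲ∣t))

∥-unique : 2^ i ∥ t → 2^ j ∥ t → i ≡ j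
∥-unique p q = ≤-antisym (∣-∥⇒≤ (∥⇒∣ p) q) (∣-∥⇒≤ (∥⇒∣ q) p)

∥-+ : 2 ^ suc k ∣ s → 2^ k ∥ t → 2^ k ∥ (s + t)
∥-+ {k} 2ᵏ⁺¹∣s t∥ = ∣∧∤⇒∥ (∣m∣n⇒∣m+n (∣-trans (n∣m*n 2) 2ᵏ⁺¹∣s) (∥⇒∣ t∥))
  (λ 2ᵏ⁺¹∣s+t → ∥⇒∤ t∥ (∣m+n∣m⇒∣n 2ᵏ⁺¹∣s+t 2ᵏ⁺¹∣s))

∥-cancelˡ : 2 ^ suc k ∣ s → 2^ k ∥ (s + t) → 2^ k ∥ t
∥-cancelˡ {k} 2ᵏ⁺¹∣s s+t∥ = ∣∧∤⇒∥ (∣m+n∣m⇒∣n (∥⇒∣ s+t∥) (∣-trans (n∣m*n 2) 2ᵏ⁺¹∣s))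
  (λ 2ᵏ⁺¹∣t → ∥⇒∤ s+t∥ (∣m∣n⇒∣m+n 2ᵏ⁺¹∣s 2ᵏ⁺¹∣t))

∥-* : 2^ i ∥ s → 2^ j ∥ t → 2^ (i + j) ∥ (s * t)
∥-* {i} {j = j} (exact m refl) (exact n refl) = exact (m + n + 2 * m * n)
  (trans (lemma (2 ^ i) (2 ^ j) m n) (cong (_* _) (sym (^-distribˡ-+-* 2 i j))))
  where
  lemma : ∀ P Q m n → P * (1 + 2 * m) * (Q * (1 + 2 * n)) ≡ P * Q * (1 + 2 * (m + n + 2 * m * n))
  lemma = solve-∀

%2≡0⇒≡2*[/2] : ∀ t → t % 2 ≡ 0 → t ≡ 2 * (t / 2)
%2≡0⇒≡2*[/2] t t%2≡0 = trans (m≡m%n+[m/n]*n t 2) (cong₂ _+_ t%2≡0 (*-comm (t / 2) 2))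

%2≢0⇒≡1+2*[/2] : ∀ t → t % 2 ≢ 0 → t ≡ 1 + 2 * (t / 2)
%2≢0⇒≡1+2*[/2] t t%2≢0 with t % 2 | m%n<n t 2 | m≡m%n+[m/n]*n t 2
... | 0 | _ | _ = ⊥-elim (t%2≢0 refl)
... | 1 | _ | t≡ = trans t≡ (cong suc (*-comm (t / 2) 2))
... | suc (suc _) | s≤s (s≤s ()) | _

ν₂-go-∥ : ∀ f t → t ≤ f → 0 < t → 2^ ν₂-go f t ∥ t
ν₂-go-∥ zero t t≤0 0<t = ⊥-elim (<⇒≱ 0<t t≤0)
ν₂-go-∥ (suc f) t t≤1+f 0<t with t ≟ 0
... | yes t≡0 = ⊥-elim (<⇒≢ 0<t (sym t≡0))
... | no _ with t % 2 ≟ 0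
...   | yes t%2≡0 = subst (2^ suc (ν₂-go f (t / 2)) ∥_) (sym t≡) (∥-* {i = 1} (exact 0 refl) (ν₂-go-∥ f (t / 2) t/2≤f 0<t/2))
  where
  t≡ : t ≡ 2 * (t / 2)
  t≡ = %2≡0⇒≡2*[/2] t t%2≡0
  t/2≤f : t / 2 ≤ f
  t/2≤f = s≤s⁻¹ (≤-trans (m/n<m t 2 ⦃ >-nonZero 0<t ⦄ (s≤s (s≤s z≤n))) t≤1+f)
  0<t/2 : 0 < t / 2
  0<t/2 = n≢0⇒n>0 (λ t/2≡0 → <⇒≢ 0<t (sym (trans t≡ (cong (2 *_) t/2≡0))))
...   | no t%2≢0 = exact (t / 2) (trans (%2≢0⇒≡1+2*[/2] t t%2≢0) (sym (*-identityˡ _)))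

∥-ν₂ : 0 < t → 2^ ν₂ t ∥ t
∥-ν₂ {t} = ν₂-go-∥ t t ≤-refl

∥[m∸1]⇒1<m : ∀ m → 2^ k ∥ (m ∸ 1) → 1 < m
∥[m∸1]⇒1<m zero p with () ← ∥⇒0< p
∥[m∸1]⇒1<m (suc zero) p with () ← ∥⇒0< p
∥[m∸1]⇒1<m (suc (suc m)) p = s≤s (s≤s z≤n)

∥[m∸1]⇒2∣m+1 : ∀ m → 2^ suc j ∥ (m ∸ 1) → 2 ∣ m + 1
∥[m∸1]⇒2∣m+1 zero p with () ← ∥⇒0< p
∥[m∸1]⇒2∣m+1 {j} (suc m) (exact q refl) = divides (2 ^ j * (1 + 2 * q) + 1) (lemma (2 ^ j) (1 + 2 * q))
  where
  lemma : ∀ P o → suc (2 * P * o) + 1 ≡ (P * o + 1) * 2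
  lemma = solve-∀

∥[m∸1]⇒2¹∥m+1 : ∀ m → 2 ≤ i → 2^ i ∥ (m ∸ 1) → 2^ 1 ∥ (m + 1)
∥[m∸1]⇒2¹∥m+1 zero _ p with () ← ∥⇒0< p
∥[m∸1]⇒2¹∥m+1 {suc zero} (suc m) (s≤s ()) _
∥[m∸1]⇒2¹∥m+1 {suc (suc j)} (suc m) _ (exact q refl) = exact (2 ^ j * (1 + 2 * q)) (lemma (2 ^ j) (1 + 2 * q))
  where
  lemma : ∀ P o → suc (2 * (2 * P) * o) + 1 ≡ 2 ^ 1 * (1 + 2 * (P * o))
  lemma = solve-∀

∥[m∸1]⇒∣[m*m∸1] : ∀ m → 2^ suc j ∥ (m ∸ 1) → 2 ^ suc (suc j) ∣ m * m ∸ 1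
∥[m∸1]⇒∣[m*m∸1] {j} m p = subst (2 ^ suc (suc j) ∣_) ([m∸1]*[m+1]≡m*m∸1 m)
  (subst (_∣ (m ∸ 1) * (m + 1)) (*-comm (2 ^ suc j) 2) (*-pres-∣ (∥⇒∣ p) (∥[m∸1]⇒2∣m+1 m p)))

∥-square∸1 : ∀ m → 2^ i ∥ (m ∸ 1) → 2^ j ∥ (m + 1) → 2^ (i + j) ∥ (m * m ∸ 1)
∥-square∸1 {i} {j} m p q = subst (2^ (i + j) ∥_) ([m∸1]*[m+1]≡m*m∸1 m) (∥-* p q)

∥-pow∸1-odd : ∀ a → 0 < i → 2^ i ∥ (a ∸ 1) → 2^ 0 ∥ e → 2^ i ∥ (a ^ e ∸ 1)
∥-pow∸1-odd {suc j} a _ p (exact m refl) =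
  subst (λ e → 2^ suc j ∥ (a ^ e ∸ 1)) (sym (*-identityˡ (1 + 2 * m))) (odd-powers m)
  where
  0<a : 0 < a
  0<a = <-trans (s≤s z≤n) (∥[m∸1]⇒1<m a p)
  odd-powers : ∀ m → 2^ suc j ∥ (a ^ (1 + 2 * m) ∸ 1)
  odd-powers zero = subst (λ b → 2^ suc j ∥ (b ∸ 1)) (sym (*-identityʳ a)) p
  odd-powers (suc m) = subst (λ b → 2^ suc j ∥ (b ∸ 1)) (sym (^-odd-suc a m))
    (subst (2^ suc j ∥_) (sym (m*n∸1≡[m∸1]*n+[n∸1] (a * a) (a ^ (1 + 2 * m)) (*-mono-< 0<a 0<a) (m^n>0 a ⦃ >-nonZero 0<a ⦄ (1 + 2 * m))))
      (∥-+ (∣m⇒∣m*n (a ^ (1 + 2 * m)) (∥[m∸1]⇒∣[m*m∸1] a p)) (odd-powers m)))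

∥-pow∸1 : ∀ a → 2 ≤ i → 2^ i ∥ (a ∸ 1) → 2^ k ∥ e → 2^ (i + k) ∥ (a ^ e ∸ 1)
∥-pow∸1 {i} {k = zero} {e} a 2≤i p e∥ =
  subst (λ s → 2^ s ∥ (a ^ e ∸ 1)) (sym (+-identityʳ i)) (∥-pow∸1-odd a (≤-trans (s≤s z≤n) 2≤i) p e∥)
∥-pow∸1 {i} {suc k} a 2≤i p (exact m refl) =
  subst₂ (λ s b → 2^ s ∥ (b ∸ 1)) (+-assoc i 1 k) (sym (^-2^suc a k (1 + 2 * m)))
    (∥-pow∸1 (a * a) (≤-trans 2≤i (m≤m+n i 1)) (∥-square∸1 a p (∥[m∸1]⇒2¹∥m+1 a 2≤i p)) (exact m refl))

∥-pow∸1-3mod4 : ∀ a → 2^ 1 ∥ (a ∸ 1) → 2 ≤ j → 2^ j ∥ (a + 1) → 2^ suc k ∥ e → 2^ (j + suc k) ∥ (a ^ e ∸ 1)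
∥-pow∸1-3mod4 {j} {k} a p 2≤j q (exact m refl) =
  subst₂ (λ s b → 2^ s ∥ (b ∸ 1)) (sym (+-suc j k)) (sym (^-2^suc a k (1 + 2 * m)))
    (∥-pow∸1 (a * a) (m≤n⇒m≤1+n 2≤j) (∥-square∸1 a p q) (exact m refl))

same-valuation⇒square : 2^ k ∥ x → 2^ k ∥ z → x < z → n ^ (z ∸ x) ≡ b ^ x → IsSquare b
same-valuation⇒square {b = zero} _ _ _ _ = 0 , refl
same-valuation⇒square {k} {n = n} {b = suc b} (exact m refl) (exact p refl) x<z nᶻ⁻ˣ≡bˣ =
  square-cofactor {e = n ^ r} (m^n>0 (suc b) m) (begin
    suc b * (suc b ^ m * suc b ^ m)  ≡⟨ cong (suc b *_) (sym (^-2* (suc b) m)) ⟩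
    suc b ^ (1 + 2 * m)              ≡⟨ sym root ⟩
    n ^ (2 * r)                      ≡⟨ ^-2* n r ⟩
    n ^ r * n ^ r                    ∎)
  where
  open ≡-Reasoning
  P = 2 ^ k
  ^-2* : ∀ a e → a ^ (2 * e) ≡ a ^ e * a ^ e
  ^-2* a e = trans (^-distribˡ-+-* a e (e + 0)) (cong (λ s → a ^ e * a ^ s) (+-identityʳ e))
  ^-P* : ∀ a e → a ^ (P * e) ≡ (a ^ e) ^ P
  ^-P* a e = trans (cong (a ^_) (*-comm P e)) (sym (^-*-assoc a e P))
  m<p : m < p
  m<p = *-cancelˡ-< 2 m p (s≤s⁻¹ (*-cancelˡ-< P (1 + 2 * m) (1 + 2 * p) x<z))
  r = p ∸ m
  split : ∀ P m r → P * (1 + 2 * (m + r)) ≡ P * (1 + 2 * m) + P * (2 * r)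
  split = solve-∀
  z∸x≡ : P * (1 + 2 * p) ∸ P * (1 + 2 * m) ≡ P * (2 * r)
  z∸x≡ = trans (cong (λ s → P * (1 + 2 * s) ∸ P * (1 + 2 * m)) (sym (m+[n∸m]≡n (<⇒≤ m<p))))
           (trans (cong (_∸ P * (1 + 2 * m)) (split P m r)) (m+n∸m≡n (P * (1 + 2 * m)) (P * (2 * r))))
  root : n ^ (2 * r) ≡ suc b ^ (1 + 2 * m)
  root = ^-cancelʳ-≡ P (m^n>0 2 k) (begin
    (n ^ (2 * r)) ^ P                  ≡⟨ sym (^-P* n (2 * r)) ⟩
    n ^ (P * (2 * r))                  ≡⟨ cong (n ^_) (sym z∸x≡) ⟩
    n ^ (P * (1 + 2 * p) ∸ P * (1 + 2 * m)) ≡⟨ nᶻ⁻ˣ≡bˣ ⟩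
    suc b ^ (P * (1 + 2 * m))          ≡⟨ ^-P* (suc b) (1 + 2 * m) ⟩
    (suc b ^ (1 + 2 * m)) ^ P          ∎)

odd-factor : ∀ a b → (a * b) % 2 ≡ 1 → a % 2 ≡ 1
odd-factor a b ab%2≡1 with a % 2 | m%n<n a 2 | %-distribˡ-* a b 2
... | 0 | _ | ab%2≡0 with () ← trans (sym ab%2≡0) ab%2≡1
... | 1 | _ | _ = refl
... | suc (suc _) | s≤s (s≤s ()) | _

odd-residue-mod8 : ∀ m → m % 2 ≡ 1 → m % 8 ≡ 1 ⊎ m % 8 ≡ 3 ⊎ m % 8 ≡ 5 ⊎ m % 8 ≡ 7
odd-residue-mod8 m m%2≡1 with m % 8 | m%n<n m 8 | m∣n⇒o%n%m≡o%m 2 8 m (divides 4 refl)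
... | 0 | _ | r%2≡m%2 with () ← trans r%2≡m%2 m%2≡1
... | 1 | _ | _ = inj₁ refl
... | 2 | _ | r%2≡m%2 with () ← trans r%2≡m%2 m%2≡1
... | 3 | _ | _ = inj₂ (inj₁ refl)
... | 4 | _ | r%2≡m%2 with () ← trans r%2≡m%2 m%2≡1
... | 5 | _ | _ = inj₂ (inj₂ (inj₁ refl))
... | 6 | _ | r%2≡m%2 with () ← trans r%2≡m%2 m%2≡1
... | 7 | _ | _ = inj₂ (inj₂ (inj₂ refl))
... | suc (suc (suc (suc (suc (suc (suc (suc _))))))) | s≤s (s≤s (s≤s (s≤s (s≤s (s≤s (s≤s (s≤s ()))))))) | _

odd⇒square%8≡1 : ∀ m → m % 2 ≡ 1 → (m * m) % 8 ≡ 1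
odd⇒square%8≡1 m m%2≡1 = trans (%-distribˡ-* m m 8) (square-residue (odd-residue-mod8 m m%2≡1))
  where
  square-residue : m % 8 ≡ 1 ⊎ m % 8 ≡ 3 ⊎ m % 8 ≡ 5 ⊎ m % 8 ≡ 7 → ((m % 8) * (m % 8)) % 8 ≡ 1
  square-residue (inj₁ r) = cong (λ r → (r * r) % 8) r
  square-residue (inj₂ (inj₁ r)) = cong (λ r → (r * r) % 8) r
  square-residue (inj₂ (inj₂ (inj₁ r))) = cong (λ r → (r * r) % 8) r
  square-residue (inj₂ (inj₂ (inj₂ r))) = cong (λ r → (r * r) % 8) r

%8≡⇒≡+/8*8 : ∀ m {r} → m % 8 ≡ r → m ≡ r + m / 8 * 8
%8≡⇒≡+/8*8 m refl = m≡m%n+[m/n]*n m 8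

odd⇒4∥m*m+4∸1 : ∀ m → m % 2 ≡ 1 → 2^ 2 ∥ (m * m + 4 ∸ 1)
odd⇒4∥m*m+4∸1 m m%2≡1 = exact q (trans (cong (λ s → s + 4 ∸ 1) m*m≡) (lemma q))
  where
  q = (m * m) / 8
  m*m≡ = %8≡⇒≡+/8*8 (m * m) (odd⇒square%8≡1 m m%2≡1)
  lemma : ∀ q → q * 8 + 4 ≡ 2 ^ 2 * (1 + 2 * q)
  lemma = solve-∀

odd≢1⇒[m*m∸4]%8≡5 : ∀ m → m % 2 ≡ 1 → m ≢ 1 → (m * m ∸ 4) % 8 ≡ 5
odd≢1⇒[m*m∸4]%8≡5 m m%2≡1 m≢1 with (m * m) / 8 | %8≡⇒≡+/8*8 (m * m) (odd⇒square%8≡1 m m%2≡1)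
... | zero | m*m≡1 = ⊥-elim (m≢1 (m*n≡1⇒m≡1 m m m*m≡1))
... | suc q | m*m≡9+q*8 = trans (cong (λ s → (s ∸ 4) % 8) m*m≡9+q*8) ([m+kn]%n≡m%n 5 q 8)

%8≡1⇒8∣m∸1 : ∀ m → m % 8 ≡ 1 → 2 ^ 3 ∣ m ∸ 1
%8≡1⇒8∣m∸1 m m%8≡1 = divides (m / 8) (cong (_∸ 1) (%8≡⇒≡+/8*8 m m%8≡1))

%8≡5⇒4∥m∸1 : ∀ m → m % 8 ≡ 5 → 2^ 2 ∥ (m ∸ 1)
%8≡5⇒4∥m∸1 m m%8≡5 = exact (m / 8) (trans (cong (_∸ 1) (%8≡⇒≡+/8*8 m m%8≡5)) (lemma (m / 8)))
  where
  lemma : ∀ q → 4 + q * 8 ≡ 2 ^ 2 * (1 + 2 * q)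
  lemma = solve-∀

%8≡3⇒2∥m∸1×4∥m+1 : ∀ m → m % 8 ≡ 3 → 2^ 1 ∥ (m ∸ 1) × 2^ 2 ∥ (m + 1)
%8≡3⇒2∥m∸1×4∥m+1 m m%8≡3 =
  exact (2 * q) (trans (cong (_∸ 1) m≡) (lemma₁ q)) , exact q (trans (cong (_+ 1) m≡) (lemma₂ q))
  where
  q = m / 8
  m≡ = %8≡⇒≡+/8*8 m m%8≡3
  lemma₁ : ∀ q → 2 + q * 8 ≡ 2 ^ 1 * (1 + 2 * (2 * q))
  lemma₁ = solve-∀
  lemma₂ : ∀ q → 3 + q * 8 + 1 ≡ 2 ^ 2 * (1 + 2 * q)
  lemma₂ = solve-∀

%8≡7⇒2∥m∸1×8∣m+1 : ∀ m → m % 8 ≡ 7 → 2^ 1 ∥ (m ∸ 1) × 2 ^ 3 ∣ m + 1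
%8≡7⇒2∥m∸1×8∣m+1 m m%8≡7 =
  exact (1 + 2 * q) (trans (cong (_∸ 1) m≡) (lemma₁ q)) , divides (q + 1) (trans (cong (_+ 1) m≡) (lemma₂ q))
  where
  q = m / 8
  m≡ = %8≡⇒≡+/8*8 m m%8≡7
  lemma₁ : ∀ q → 6 + q * 8 ≡ 2 ^ 1 * (1 + 2 * (1 + 2 * q))
  lemma₁ = solve-∀
  lemma₂ : ∀ q → 7 + q * 8 + 1 ≡ (q + 1) * 2 ^ 3
  lemma₂ = solve-∀

%8≡3⇒¬IsSquare : ∀ a b → a % 8 ≡ 3 → (a * b) % 8 ≡ 5 → ¬ IsSquare b
%8≡3⇒¬IsSquare a _ a%8≡3 eq (f , refl) = square-residues (f % 8) (m%n<n f 8) (trans (sym to-residues) eq)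
  where
  open ≡-Reasoning
  to-residues : (a * (f * f)) % 8 ≡ (3 * (((f % 8) * (f % 8)) % 8)) % 8
  to-residues = begin
    (a * (f * f)) % 8                        ≡⟨ %-distribˡ-* a (f * f) 8 ⟩
    ((a % 8) * ((f * f) % 8)) % 8            ≡⟨ cong₂ (λ r s → (r * s) % 8) a%8≡3 (%-distribˡ-* f f 8) ⟩
    (3 * (((f % 8) * (f % 8)) % 8)) % 8      ∎
  square-residues : ∀ r → r < 8 → (3 * ((r * r) % 8)) % 8 ≢ 5
  square-residues 0 _ ()
  square-residues 1 _ ()
  square-residues 2 _ ()
  square-residues 3 _ ()
  square-residues 4 _ ()
  square-residues 5 _ ()
  square-residues 6 _ ()
  square-residues 7 _ ()
  square-residues (suc (suc (suc (suc (suc (suc (suc (suc _)))))))) (s≤s (s≤s (s≤s (s≤s (s≤s (s≤s (s≤s (s≤s ())))))))) _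

valuation-1mod4 : ∀ a → 0 < x → 2 ≤ i → 2^ i ∥ (a ∸ 1) → 2^ l ∥ (a ^ x ∸ 1) → i + ν₂ x ≡ l
valuation-1mod4 a 0<x 2≤i a∸1∥ aˣ∸1∥ = ∥-unique (∥-pow∸1 a 2≤i a∸1∥ (∥-ν₂ 0<x)) aˣ∸1∥

valuation-3mod4 : ∀ a → 0 < x → 2^ 1 ∥ (a ∸ 1) → 2 ≤ j → 2^ j ∥ (a + 1) → 2^ (2 + l) ∥ (a ^ x ∸ 1) →
  1 ≤ ν₂ x × j + ν₂ x ≡ 2 + l
valuation-3mod4 {x} a 0<x a∸1∥ 2≤j a+1∥ aˣ∸1∥ with ν₂ x | ∥-ν₂ 0<x
... | zero | x∥ with () ← ∥-unique (∥-pow∸1-odd a (s≤s z≤n) a∸1∥ x∥) aˣ∸1∥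
... | suc k | x∥ = s≤s z≤n , ∥-unique (∥-pow∸1-3mod4 a a∸1∥ 2≤j a+1∥ x∥) aˣ∸1∥

classification : ∀ a b x z → (a * b) % 8 ≡ 5 → 0 < x → 2^ (2 + ν₂ z) ∥ (a ^ x ∸ 1) →
  (ν₂ x ≡ ν₂ z → IsSquare b) →
    (a % 8 ≡ 1 × ν₂ z + 2 ≡ ν₂ (a ∸ 1) + ν₂ x)
  ⊎ (a % 8 ≡ 7 × ν₂ z + 2 ≡ ν₂ (a + 1) + ν₂ x × 1 ≤ ν₂ x)
  ⊎ (a % 8 ≡ 5 × IsSquare b × ν₂ z ≡ ν₂ x)
classification a b x z ab%8≡5 0<x aˣ∸1∥ square
  with odd-residue-mod8 a (odd-factor a b (trans (sym (m∣n⇒o%n%m≡o%m 2 8 (a * b) (divides 4 refl))) (cong (_% 2) ab%8≡5)))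
... | inj₁ a%8≡1 = inj₁ (a%8≡1 , trans (+-comm (ν₂ z) 2) (sym (valuation-1mod4 a 0<x 2≤i (∥-ν₂ 0<a∸1) aˣ∸1∥)))
  where
  0<a∸1 : 0 < a ∸ 1
  0<a∸1 = m<n⇒0<n∸m (1<^⇒1< a x (∥[m∸1]⇒1<m (a ^ x) aˣ∸1∥))
  2≤i : 2 ≤ ν₂ (a ∸ 1)
  2≤i = ≤-trans (s≤s (s≤s z≤n)) (∣-∥⇒≤ {j = 3} (%8≡1⇒8∣m∸1 a a%8≡1) (∥-ν₂ 0<a∸1))
... | inj₂ (inj₁ a%8≡3) = ⊥-elim (%8≡3⇒¬IsSquare a b a%8≡3 ab%8≡5 (square ν₂x≡ν₂z))
  where
  ν₂x≡ν₂z : ν₂ x ≡ ν₂ z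
  ν₂x≡ν₂z = +-cancelˡ-≡ 2 _ _ (proj₂ (valuation-3mod4 a 0<x (proj₁ (%8≡3⇒2∥m∸1×4∥m+1 a a%8≡3)) ≤-refl
    (proj₂ (%8≡3⇒2∥m∸1×4∥m+1 a a%8≡3)) aˣ∸1∥))
... | inj₂ (inj₂ (inj₁ a%8≡5)) = inj₂ (inj₂ (a%8≡5 , square ν₂x≡ν₂z , sym ν₂x≡ν₂z))
  where
  ν₂x≡ν₂z : ν₂ x ≡ ν₂ z
  ν₂x≡ν₂z = +-cancelˡ-≡ 2 _ _ (valuation-1mod4 a 0<x ≤-refl (%8≡5⇒4∥m∸1 a a%8≡5) aˣ∸1∥)
... | inj₂ (inj₂ (inj₂ a%8≡7)) = inj₂ (inj₁ (a%8≡7 , trans (+-comm (ν₂ z) 2) (sym j+ν₂x≡2+ν₂z) , 1≤ν₂x))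
  where
  a+1∥ : 2^ ν₂ (a + 1) ∥ (a + 1)
  a+1∥ = ∥-ν₂ (m≤n+m 1 a)
  2≤j : 2 ≤ ν₂ (a + 1)
  2≤j = ≤-trans (s≤s (s≤s z≤n)) (∣-∥⇒≤ {j = 3} (proj₂ (%8≡7⇒2∥m∸1×8∣m+1 a a%8≡7)) a+1∥)
  valuation = valuation-3mod4 a 0<x (proj₁ (%8≡7⇒2∥m∸1×8∣m+1 a a%8≡7)) 2≤j a+1∥ aˣ∸1∥
  1≤ν₂x = proj₁ valuation
  j+ν₂x≡2+ν₂z = proj₂ valuation

∥-pow∸1-cancel : 2^ 2 ∥ (c ∸ 1) → 0 < z → 2 ^ (3 + ν₂ z) ∣ s → 0 < a → s + a ≡ c ^ z →
  2^ (2 + ν₂ z) ∥ (a ∸ 1)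
∥-pow∸1-cancel {c} {z} {s} {a} c∸1∥ 0<z 2^[3+ν₂z]∣s 0<a s+a≡cᶻ = ∥-cancelˡ 2^[3+ν₂z]∣s
  (subst (2^ (2 + ν₂ z) ∥_) (trans (cong (_∸ 1) (sym s+a≡cᶻ)) (+-∸-assoc s 0<a))
    (∥-pow∸1 c ≤-refl c∸1∥ (∥-ν₂ 0<z)))

3+ν₂z≤2y : 0 < z → z < y → 3 + ν₂ z ≤ 2 * y
3+ν₂z≤2y {z} {y} 0<z z<y = subst (3 + ν₂ z ≤_) (cong (y +_) (sym (+-identityʳ y)))
  (+-mono-≤ (≤-trans (s≤s z≤n) z<y) (≤-trans (s≤s (∥⇒< (∥-ν₂ 0<z))) z<y))

2^[2y]∣[4u]^y* : ∀ u y w → 2 ^ (2 * y) ∣ (4 * u) ^ y * w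
2^[2y]∣[4u]^y* u y w = ∣m⇒∣m*n w (subst (_∣ (4 * u) ^ y) (^-*-assoc 2 2 y) (^-monoˡ-∣ y (m∣m*n u)))

lemma3p5 : (u x y z n u₁ u₂ : ℕ) → OddPrime u → IsExceptional u x y z n →
    x < z → z < y → IsAssocDecomp u x y z n u₁ u₂ →
    1 < u₁ × 1 < u₂ ×
    ((u₁ % 8 ≡ 1 × ν₂ z + 2 ≡ ν₂ (u₁ ∸ 1) + ν₂ x)
     ⊎ (u₁ % 8 ≡ 7 × ν₂ z + 2 ≡ ν₂ (u₁ + 1) + ν₂ x × 1 ≤ ν₂ x)
     ⊎ (u₁ % 8 ≡ 5 × IsSquare u₂ × ν₂ z ≡ ν₂ x))
lemma3p5 u x y z n u₁ u₂ (prime _ , u%2≡1) ((0<x , _ , 0<z , _ , _) , 1<n , _) x<z z<y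
         (0<u₁ , _ , _ , u₁u₂≡u²∸4 , X+u₁ˣ≡[u²+4]ᶻ , nᶻ⁻ˣ≡u₂ˣ) =
  1<^⇒1< u₁ x (∥[m∸1]⇒1<m (u₁ ^ x) key) ,
  1<^⇒1< u₂ x (subst (1 <_) nᶻ⁻ˣ≡u₂ˣ (^-monoʳ-< n 1<n (m<n⇒0<n∸m x<z))) ,
  classification u₁ u₂ x z u₁u₂%8≡5 0<x key square
  where
  u₁u₂%8≡5 : (u₁ * u₂) % 8 ≡ 5
  u₁u₂%8≡5 = subst (λ s → s % 8 ≡ 5) (sym u₁u₂≡u²∸4) (odd≢1⇒[m*m∸4]%8≡5 u u%2≡1 nonTrivial⇒≢1)
  key : 2^ (2 + ν₂ z) ∥ (u₁ ^ x ∸ 1)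
  key = ∥-pow∸1-cancel (odd⇒4∥m*m+4∸1 u u%2≡1) 0<z
    (∣-trans (^-monoʳ-∣ 2 (3+ν₂z≤2y 0<z z<y)) (2^[2y]∣[4u]^y* u y (n ^ (y ∸ z))))
    (m^n>0 u₁ ⦃ >-nonZero 0<u₁ ⦄ x) X+u₁ˣ≡[u²+4]ᶻ
  square : ν₂ x ≡ ν₂ z → IsSquare u₂
  square ν₂x≡ν₂z =
    same-valuation⇒square (∥-ν₂ 0<x) (subst (λ k → 2^ k ∥ z) (sym ν₂x≡ν₂z) (∥-ν₂ 0<z)) x<z nᶻ⁻ˣ≡u₂ˣ
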